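{- For every integer $k \geq 7$, \[\chi\big(K^2(2k+1,k)\big) \leq \frac{32}{15}k + 32.\]
   Context: The Kneser graph $K(n,k)$ has as vertices the $k$-element subsets of an $n$-element set, adjacent iff disjoint; $K^2(n,k)$ is its square (same vertices, two distinct vertices adjacent iff at distance at most 2 in $K(n,k)$); $\chi$ is the chromatic number. -}

module Defs where

open import Data.Nat using (ℕ; _+_; _*_; _≤_)
open import Data.Fin using (Fin)
open import Data.Fin.Subset using (Subset; _∩_; ⊥; ∣_∣)
open import Data.Product using (Σ; ∃; _×_; _,_; proj₁)
open import Data.Sum using (_⊎_)
open import Relation.Binary.PropositionalEquality using (_≡_; _≢_)

Disjoint : ∀ {n} → Subset n → Subset n → Set
Disjoint s t = s ∩ t ≡ ⊥

KVertex : ℕ → ℕ → Set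
KVertex n k = Σ (Subset n) λ s → ∣ s ∣ ≡ k

KAdj : ∀ {n k} → KVertex n k → KVertex n k → Set
KAdj u v = Disjoint (proj₁ u) (proj₁ v)

K²Adj : ∀ {n k} → KVertex n k → KVertex n k → Set
K²Adj {n} {k} u v =
  u ≢ v × (KAdj u v ⊎ ∃ λ (w : KVertex n k) → KAdj u w × KAdj w v)

ProperColouringK² : ℕ → ℕ → ℕ → Set
ProperColouringK² n k c =
  Σ (KVertex n k → Fin c) λ f → ∀ u v → K²Adj u v → f u ≢ f v

module Submission where

-- A k-subset A of [2k+1] gets the colour (⊕_{x∈A} c x , Σ_{x∈A} ℓ x mod h), where x ↦ (c x , ℓ x)
-- is an injective labelling by pairs in (𝔽₂⁴ ∖ 0) × [0, h) whose codes c x XOR to 0 over all of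
-- [2k+1].  Disjoint k-sets A, B miss exactly one element z, so the code parts of their colours
-- differ by c z ≠ 0.  Two k-sets with a common disjoint neighbour W are the complements of
-- W ∪ {a} and W ∪ {b}, so equal colours force (c a , ℓ a) ≡ (c b , ℓ b), i.e. a ≡ b.
-- Fifteen nonzero codes on h = ⌊(2k+15)/15⌋ + 1 levels suffice for the labelling, which gives
-- 16h ≤ 32k/15 + 32 colours; the construction only needs k ≥ 1.

open import Defs
open import Data.Empty using (⊥-elim)
open import Data.Fin as Fin using (Fin; combine)
open import Data.Fin.Properties using (combine-injective; fromℕ<-injective)
open import Data.Fin.Subset using (Subset; inside; outside; ⊤; ∣_∣)
open import Data.Fin.Subset.Properties using (∩-comm)
open import Data.Nat
  using (ℕ; zero; suc; _+_; _*_; _∸_; _^_; _≤_; _<_; z≤n; s≤s; s≤s⁻¹; z<s; s<s; NonZero; _/_; _%_)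
open import Data.Nat.DivMod
open import Data.Nat.Properties
open import Data.Nat.Tactic.RingSolver using (solve-∀)
open import Data.Product using (Σ; ∃₂; ∃-syntax; _×_; _,_; proj₁; proj₂)
open import Data.Sum using (_⊎_; inj₁; inj₂)
open import Data.Vec using ([]; _∷_)
open import Data.Vec.Properties using (∷-injectiveˡ; ∷-injectiveʳ)
open import Function using (_∘_)
open import Relation.Binary.PropositionalEquality
open import Relation.Nullary using (¬_; yes; no)
open import Algebra.Properties.CommutativeSemigroup +-commutativeSemigroup
  using (x∙yz≈y∙xz; x∙yz≈xz∙y; xy∙z≈y∙xz; xy∙z≈xz∙y)

weight : ∀ {n} → (ℕ → ℕ) → Subset n → ℕ
weight w []            = 0
weight w (inside ∷ A)  = w 0 + weight (w ∘ suc) A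
weight w (outside ∷ A) = weight (w ∘ suc) A

weight-zero : ∀ {n} (A : Subset n) → weight (λ _ → 0) A ≡ 0
weight-zero []            = refl
weight-zero (inside ∷ A)  = weight-zero A
weight-zero (outside ∷ A) = weight-zero A

inside≢outside : ∀ {n} {A B : Subset n} → ¬ (∀ w → weight w (inside ∷ A) ≡ weight w (outside ∷ B))
inside≢outside {A = A} {B} eq = 1+n≢0 (begin
  suc (weight (λ _ → 0) A) ≡⟨ eq (λ { zero → 1 ; (suc _) → 0 }) ⟩
  weight (λ _ → 0) B       ≡⟨ weight-zero B ⟩
  0                        ∎)
  where open ≡-Reasoning

weight-injective : ∀ {n} {A B : Subset n} → (∀ w → weight w A ≡ weight w B) → A ≡ B
weight-injective {A = []}          {[]}          eq = refl
weight-injective {A = inside ∷ A}  {inside ∷ B}  eq =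
  cong (inside ∷_) (weight-injective λ w → eq λ { zero → 0 ; (suc x) → w x })
weight-injective {A = outside ∷ A} {outside ∷ B} eq =
  cong (outside ∷_) (weight-injective λ w → eq λ { zero → 0 ; (suc x) → w x })
weight-injective {A = inside ∷ A}  {outside ∷ B} eq = ⊥-elim (inside≢outside {A = A} {B} eq)
weight-injective {A = outside ∷ A} {inside ∷ B}  eq = ⊥-elim (inside≢outside {A = B} {A} (sym ∘ eq))

¬disjoint-inside : ∀ {n} {A B : Subset n} → ¬ Disjoint (inside ∷ A) (inside ∷ B)
¬disjoint-inside eq with ∷-injectiveˡ eq
... | ()

disjoint-sym : ∀ {n} {A B : Subset n} → Disjoint A B → Disjoint B A
disjoint-sym {A = A} {B} eq = trans (∩-comm B A) eq

disjoint⇒∣A∣+∣B∣≤n : ∀ {n} {A B : Subset n} → Disjoint A B → ∣ A ∣ + ∣ B ∣ ≤ n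
disjoint⇒∣A∣+∣B∣≤n {A = []}          {[]}          _ = z≤n
disjoint⇒∣A∣+∣B∣≤n {A = inside ∷ A}  {inside ∷ B}  d = ⊥-elim (¬disjoint-inside d)
disjoint⇒∣A∣+∣B∣≤n {A = inside ∷ A}  {outside ∷ B} d = s≤s (disjoint⇒∣A∣+∣B∣≤n (∷-injectiveʳ d))
disjoint⇒∣A∣+∣B∣≤n {A = outside ∷ A} {inside ∷ B}  d rewrite +-suc ∣ A ∣ ∣ B ∣ =
  s≤s (disjoint⇒∣A∣+∣B∣≤n (∷-injectiveʳ d))
disjoint⇒∣A∣+∣B∣≤n {A = outside ∷ A} {outside ∷ B} d = m≤n⇒m≤1+n (disjoint⇒∣A∣+∣B∣≤n (∷-injectiveʳ d))

weight-partition : ∀ {n} {A B : Subset n} → Disjoint A B → ∣ A ∣ + ∣ B ∣ ≡ n →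
                   ∀ w → weight w A + weight w B ≡ weight w (⊤ {n})
weight-partition {A = []}          {[]}          _ _ _ = refl
weight-partition {A = inside ∷ A}  {inside ∷ B}  d = ⊥-elim (¬disjoint-inside d)
weight-partition {A = inside ∷ A}  {outside ∷ B} d size w =
  trans (+-assoc (w 0) (weight (w ∘ suc) A) (weight (w ∘ suc) B))
        (cong (w 0 +_) (weight-partition (∷-injectiveʳ d) (suc-injective size) (w ∘ suc)))
weight-partition {A = outside ∷ A} {inside ∷ B}  d size w =
  trans (x∙yz≈y∙xz (weight (w ∘ suc) A) (w 0) (weight (w ∘ suc) B))
        (cong (w 0 +_) (weight-partition (∷-injectiveʳ d) (suc-injective (trans (sym (+-suc ∣ A ∣ ∣ B ∣)) size)) (w ∘ suc)))
weight-partition {n = suc n} {A = outside ∷ A} {outside ∷ B} d size =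
  ⊥-elim (1+n≰n (subst (_≤ n) size (disjoint⇒∣A∣+∣B∣≤n (∷-injectiveʳ d))))

weight-partition-but-one : ∀ {n} {A B : Subset n} → Disjoint A B → suc (∣ A ∣ + ∣ B ∣) ≡ n →
  ∃[ z ] z < n × ∀ w → weight w A + w z + weight w B ≡ weight w (⊤ {n})
weight-partition-but-one {A = []}          {[]}          _ ()
weight-partition-but-one {A = inside ∷ A}  {inside ∷ B}  d = ⊥-elim (¬disjoint-inside d)
weight-partition-but-one {A = inside ∷ A}  {outside ∷ B} d size
  with z , z<n , sum ← weight-partition-but-one (∷-injectiveʳ d) (suc-injective size) =
  suc z , s≤s z<n , λ w → let a = weight (w ∘ suc) A; b = weight (w ∘ suc) B in
    trans (cong (_+ b) (+-assoc (w 0) a (w (suc z))))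
          (trans (+-assoc (w 0) (a + w (suc z)) b) (cong (w 0 +_) (sum (w ∘ suc))))
weight-partition-but-one {A = outside ∷ A} {inside ∷ B}  d size
  with z , z<n , sum ← weight-partition-but-one (∷-injectiveʳ d)
                         (suc-injective (trans (sym (cong suc (+-suc ∣ A ∣ ∣ B ∣))) size)) =
  suc z , s≤s z<n , λ w →
    trans (x∙yz≈y∙xz (weight (w ∘ suc) A + w (suc z)) (w 0) (weight (w ∘ suc) B))
          (cong (w 0 +_) (sum (w ∘ suc)))
weight-partition-but-one {A = outside ∷ A} {outside ∷ B} d size =
  0 , s≤s z≤n , λ w →
    trans (xy∙z≈y∙xz (weight (w ∘ suc) A) (w 0) (weight (w ∘ suc) B))
          (cong (w 0 +_) (weight-partition (∷-injectiveʳ d) (suc-injective size) (w ∘ suc)))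

common-neighbour⇒exchange : ∀ {n} {A B W : Subset n} → Disjoint A W → Disjoint W B →
  suc (∣ A ∣ + ∣ W ∣) ≡ n → suc (∣ B ∣ + ∣ W ∣) ≡ n →
  ∃₂ λ a b → a < n × b < n × ∀ w → weight w A + w a ≡ weight w B + w b
common-neighbour⇒exchange {W = W} A∩W W∩B sizeA sizeB
  with a , a<n , sumA ← weight-partition-but-one A∩W sizeA
     | b , b<n , sumB ← weight-partition-but-one (disjoint-sym W∩B) sizeB =
  a , b , a<n , b<n , λ w → +-cancelʳ-≡ (weight w W) _ _ (trans (sumA w) (sym (sumB w)))

common-neighbour⇒≡⊎exchange : ∀ {n} {A B W : Subset n} → Disjoint A W → Disjoint W B →
  suc (∣ A ∣ + ∣ W ∣) ≡ n → suc (∣ B ∣ + ∣ W ∣) ≡ n →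
  A ≡ B ⊎ ∃₂ λ a b → a < n × b < n × a ≢ b × ∀ w → weight w A + w a ≡ weight w B + w b
common-neighbour⇒≡⊎exchange A∩W W∩B sizeA sizeB
  with a , b , a<n , b<n , exchange ← common-neighbour⇒exchange A∩W W∩B sizeA sizeB
  with a ≟ b
... | yes refl = inj₁ (weight-injective λ w → +-cancelʳ-≡ (w a) _ _ (exchange w))
... | no a≢b   = inj₂ (a , b , a<n , b<n , a≢b , exchange)

mod-≡⇒%-≡ : ∀ {m} .{{_ : NonZero m}} a b → a mod m ≡ b mod m → a % m ≡ b % m
mod-≡⇒%-≡ {m} a b = fromℕ<-injective (a % m) (b % m) (m%n<n a m) (m%n<n b m)

+-cancelˡ-≡-mod : ∀ m .{{_ : NonZero m}} {r s a b} → r % m ≡ s % m → r + a ≡ s + b →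
            a < m → b < m → a ≡ b
+-cancelˡ-≡-mod m {r} {s} {a} {b} r≡s r+a≡s+b a<m b<m = begin
  a                     ≡⟨ m<n⇒m%n≡m a<m ⟨
  a % m                 ≡⟨ [m+kn]%n≡m%n a (r / m) m ⟨
  (a + r / m * m) % m   ≡⟨ cong (_% m) quotients ⟩
  (b + s / m * m) % m   ≡⟨ [m+kn]%n≡m%n b (s / m) m ⟩
  b % m                 ≡⟨ m<n⇒m%n≡m b<m ⟩
  b                     ∎
  where
  open ≡-Reasoning
  split : ∀ x c → x % m + (c + x / m * m) ≡ x + c
  split x c = trans (x∙yz≈xz∙y (x % m) c (x / m * m)) (cong (_+ c) (sym (m≡m%n+[m/n]*n x m)))
  quotients : a + r / m * m ≡ b + s / m * m
  quotients = +-cancelˡ-≡ (r % m) _ _ (begin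
    r % m + (a + r / m * m) ≡⟨ split r a ⟩
    r + a                   ≡⟨ r+a≡s+b ⟩
    s + b                   ≡⟨ split s b ⟨
    s % m + (b + s / m * m) ≡⟨ cong (_+ (b + s / m * m)) r≡s ⟨
    r % m + (b + s / m * m) ∎)

[m+kn]/n≡k : ∀ {m} k n .{{_ : NonZero n}} → m < n → (m + k * n) / n ≡ k
[m+kn]/n≡k {m} k n m<n = sym (*-cancelʳ-≡ k ((m + k * n) / n) n (+-cancelˡ-≡ m _ _ (begin
  m + k * n                             ≡⟨ m≡m%n+[m/n]*n (m + k * n) n ⟩
  (m + k * n) % n + (m + k * n) / n * n ≡⟨ cong (_+ (m + k * n) / n * n) ([m+kn]%n≡m%n m k n) ⟩
  m % n + (m + k * n) / n * n           ≡⟨ cong (_+ (m + k * n) / n * n) (m<n⇒m%n≡m m<n) ⟩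
  m + (m + k * n) / n * n               ∎)))
  where open ≡-Reasoning

*-≤⇒≤-/ : ∀ d .{{_ : NonZero d}} {m n} → d * m ≤ n → m ≤ n / d
*-≤⇒≤-/ d {m} {n} le = subst (_≤ n / d) (m*n/n≡m m d) (/-monoˡ-≤ d (subst (_≤ n) (*-comm d m) le))

m%2≡n%2⇒[m+n]%2≡0 : ∀ m n → m % 2 ≡ n % 2 → (m + n) % 2 ≡ 0
m%2≡n%2⇒[m+n]%2≡0 m n eq = begin
  (m + n) % 2             ≡⟨ %-distribˡ-+ m n 2 ⟩
  (m % 2 + n % 2) % 2     ≡⟨ cong (λ r → (m % 2 + r) % 2) eq ⟨
  (m % 2 + m % 2) % 2     ≡⟨ double (m % 2) (m%n<n m 2) ⟩
  0                       ∎
  where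
  open ≡-Reasoning
  double : ∀ r → r < 2 → (r + r) % 2 ≡ 0
  double 0 _ = refl
  double 1 _ = refl
  double (suc (suc _)) (s≤s (s≤s ()))

[m+n]%2≡0 : ∀ m n → m % 2 ≡ 0 → n % 2 ≡ 0 → (m + n) % 2 ≡ 0
[m+n]%2≡0 m n m-even n-even = trans (%-distribˡ-+ m n 2) (cong₂ (λ a b → (a + b) % 2) m-even n-even)

bit : ℕ → ℕ → ℕ
bit zero    v = v % 2
bit (suc i) v = bit i (v / 2)

bit<2 : ∀ i v → bit i v < 2
bit<2 zero    v = m%n<n v 2
bit<2 (suc i) v = bit<2 i (v / 2)

bit-0 : ∀ i → bit i 0 ≡ 0
bit-0 zero    = refl
bit-0 (suc i) = bit-0 i

half<2^r : ∀ r {v} → v < 2 ^ suc r → v / 2 < 2 ^ r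
half<2^r r {v} v< = m<n*o⇒m/o<n (subst (v <_) (*-comm 2 (2 ^ r)) v<)

bits-injective : ∀ r {u v} → u < 2 ^ r → v < 2 ^ r → (∀ {i} → i < r → bit i u ≡ bit i v) → u ≡ v
bits-injective zero    {0}     {0}     _ _ _ = refl
bits-injective zero    {suc _} {_}     (s≤s ()) _ _
bits-injective zero    {_}     {suc _} _ (s≤s ()) _
bits-injective (suc r) {u} {v} u< v< same = begin
  u                 ≡⟨ m≡m%n+[m/n]*n u 2 ⟩
  u % 2 + u / 2 * 2 ≡⟨ cong₂ (λ b h → b + h * 2) (same z<s) halves ⟩
  v % 2 + v / 2 * 2 ≡⟨ m≡m%n+[m/n]*n v 2 ⟨
  v                 ∎
  where
  open ≡-Reasoning
  halves : u / 2 ≡ v / 2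
  halves = bits-injective r (half<2^r r u<) (half<2^r r v<) (λ i<r → same (s<s i<r))

nonzero⇒bit≡1 : ∀ r {v} → 0 < v → v < 2 ^ r → ∃[ i ] i < r × bit i v ≡ 1
nonzero⇒bit≡1 zero    {suc _} _ (s≤s ())
nonzero⇒bit≡1 (suc r) {1}     _ _ = 0 , z<s , refl
nonzero⇒bit≡1 (suc r) {v@(suc (suc _))} _ v< with v % 2 in v%2 | m%n<n v 2
... | 1 | _ = 0 , z<s , v%2
... | 0 | _ with i , i<r , bit≡1 ← nonzero⇒bit≡1 r (m≥n⇒m/n>0 {v} (s≤s (s≤s z≤n))) (half<2^r r v<) =
  suc i , s<s i<r , bit≡1
... | suc (suc _) | s≤s (s≤s ())

-- The XOR of the r-bit codes c x over x ∈ A, stored as one parity per bit.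
parities : ∀ {n} r → (ℕ → ℕ) → Subset n → Fin (2 ^ r)
parities zero    c A = Fin.zero
parities (suc r) c A = combine (weight (bit 0 ∘ c) A mod 2) (parities r (λ x → c x / 2) A)

parities-≡ : ∀ {n} r c {A B : Subset n} → parities r c A ≡ parities r c B →
             ∀ {i} → i < r → weight (bit i ∘ c) A % 2 ≡ weight (bit i ∘ c) B % 2
parities-≡ (suc r) c {A} {B} eq {i} i<1+r
  with same-bit , same-rest ← combine-injective (weight (bit 0 ∘ c) A mod 2) (parities r (λ x → c x / 2) A)
                                                (weight (bit 0 ∘ c) B mod 2) (parities r (λ x → c x / 2) B) eq
  with i | i<1+r
... | zero  | _         = mod-≡⇒%-≡ (weight (bit 0 ∘ c) A) (weight (bit 0 ∘ c) B) same-bit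
... | suc i | s≤s i<r   = parities-≡ r (λ x → c x / 2) {A} {B} same-rest i<r

record Labelling (n r h : ℕ) : Set where
  field
    code            : ℕ → ℕ
    level           : ℕ → ℕ
    code-nonzero    : ∀ {x} → x < n → 0 < code x
    code<2^r        : ∀ {x} → x < n → code x < 2 ^ r
    level<h         : ∀ {x} → x < n → level x < h
    code-xor-zero   : ∀ {i} → i < r → weight (bit i ∘ code) (⊤ {n}) % 2 ≡ 0
    label-injective : ∀ {x y} → x < n → y < n → code x ≡ code y → level x ≡ level y → x ≡ y

suc[k+k]≡2k+1 : ∀ {k a b} → a ≡ k → b ≡ k → suc (a + b) ≡ 2 * k + 1
suc[k+k]≡2k+1 {k} refl refl =
  sym (trans (+-comm (2 * k) 1) (cong (λ m → suc (k + m)) (+-identityʳ k)))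

module _ {k r h} .{{_ : NonZero h}} (L : Labelling (2 * k + 1) r h) where
  open Labelling L

  colour : Subset (2 * k + 1) → Fin (2 ^ r * h)
  colour A = combine (parities r code A) (weight level A mod h)

  colour-≡ : ∀ {A B} → colour A ≡ colour B →
    (∀ {i} → i < r → weight (bit i ∘ code) A % 2 ≡ weight (bit i ∘ code) B % 2) ×
    weight level A % h ≡ weight level B % h
  colour-≡ {A} {B} eq with same-parities , same-level ← combine-injective _ _ _ _ eq =
    parities-≡ r code same-parities , mod-≡⇒%-≡ (weight level A) (weight level B) same-level

  adjacent⇒colour-≢ : ∀ (u v : KVertex (2 * k + 1) k) → KAdj u v → colour (proj₁ u) ≢ colour (proj₁ v)
  adjacent⇒colour-≢ (A , ∣A∣≡k) (B , ∣B∣≡k) A∩B same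
    with z , z<n , sum ← weight-partition-but-one A∩B (suc[k+k]≡2k+1 ∣A∣≡k ∣B∣≡k)
    with i , i<r , bit≡1 ← nonzero⇒bit≡1 r (code-nonzero z<n) (code<2^r z<n) =
    1+n≢0 (+-cancelˡ-≡-mod 2 (trans even (sym (code-xor-zero i<r))) total (s<s z<s) z<s)
    where
    w : ℕ → ℕ
    w = bit i ∘ code
    even : (weight w A + weight w B) % 2 ≡ 0
    even = m%2≡n%2⇒[m+n]%2≡0 (weight w A) (weight w B) (proj₁ (colour-≡ same) i<r)
    total : weight w A + weight w B + 1 ≡ weight w (⊤ {2 * k + 1}) + 0
    total = begin
      weight w A + weight w B + 1   ≡⟨ cong (weight w A + weight w B +_) bit≡1 ⟨
      weight w A + weight w B + w z ≡⟨ xy∙z≈xz∙y (weight w A) (w z) (weight w B) ⟨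
      weight w A + w z + weight w B ≡⟨ sum w ⟩
      weight w (⊤ {2 * k + 1})      ≡⟨ +-identityʳ _ ⟨
      weight w (⊤ {2 * k + 1}) + 0  ∎
      where open ≡-Reasoning

  distance-two⇒colour-≢ : ∀ (u w v : KVertex (2 * k + 1) k) → u ≢ v → KAdj u w → KAdj w v →
                          colour (proj₁ u) ≢ colour (proj₁ v)
  distance-two⇒colour-≢ (A , ∣A∣≡k) (W , ∣W∣≡k) (B , ∣B∣≡k) u≢v A∩W W∩B same
    with common-neighbour⇒≡⊎exchange A∩W W∩B
           (suc[k+k]≡2k+1 ∣A∣≡k ∣W∣≡k) (suc[k+k]≡2k+1 ∣B∣≡k ∣W∣≡k)
  ... | inj₁ refl = u≢v (cong (A ,_) (≡-irrelevant ∣A∣≡k ∣B∣≡k))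
  ... | inj₂ (a , b , a<n , b<n , a≢b , exchange) =
    a≢b (label-injective a<n b<n same-code same-level)
    where
    same-code : code a ≡ code b
    same-code = bits-injective r (code<2^r a<n) (code<2^r b<n) λ {i} i<r →
      +-cancelˡ-≡-mod 2 (proj₁ (colour-≡ same) i<r) (exchange (bit i ∘ code))
        (bit<2 i (code a)) (bit<2 i (code b))
    same-level : level a ≡ level b
    same-level = +-cancelˡ-≡-mod h (proj₂ (colour-≡ same)) (exchange level) (level<h a<n) (level<h b<n)

labelling⇒colouring : ∀ {k r h} .{{_ : NonZero h}} → Labelling (2 * k + 1) r h →
                      ProperColouringK² (2 * k + 1) k (2 ^ r * h)
labelling⇒colouring {k} L = (λ u → colour {k} L (proj₁ u)) , proper
  where
  proper : ∀ (u v : KVertex (2 * k + 1) k) → K²Adj u v → colour {k} L (proj₁ u) ≢ colour {k} L (proj₁ v)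
  proper u v (_   , inj₁ u∩v)             = adjacent⇒colour-≢ {k} L u v u∩v
  proper u v (u≢v , inj₂ (w , u∩w , w∩v)) = distance-two⇒colour-≢ {k} L u w v u≢v u∩w w∩v

top : ℕ → ℕ
top k = (2 * k + 15) / 15

pairCode : ℕ → ℕ
pairCode y = 15 ∸ y / 2 % 15

pairLevel : ℕ → ℕ
pairLevel y = y % 2 + y / 2 / 15 * 2

-- Elements 0, 1, 2 get the codes 1, 2, 3 (which XOR to 0) on the top level.  Element 3 + y lies
-- in the pair j = ⌊y/2⌋, which gets the code 15 ∸ j % 15 on the levels 2 ⌊j/15⌋ + y % 2, so
-- the codes of a pair cancel.  Codes run downwards within a block of 15 pairs so that the
-- codes 1, 2, 3 reappear only late in a block, which stays strictly below the top level.
code : ℕ → ℕ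
code 0                   = 1
code 1                   = 2
code 2                   = 3
code (suc (suc (suc y))) = pairCode y

level : ℕ → ℕ → ℕ
level k 0                   = top k
level k 1                   = top k
level k 2                   = top k
level k (suc (suc (suc y))) = pairLevel y

decompose : ∀ y → y ≡ y % 2 + (y / 2 % 15 + y / 2 / 15 * 15) * 2
decompose y = trans (m≡m%n+[m/n]*n y 2) (cong (λ j → y % 2 + j * 2) (m≡m%n+[m/n]*n (y / 2) 15))

pair-bound : ∀ β i t K → β < 2 → 3 + (β + (i + t * 15) * 2) ≤ K → 15 * (β + t * 2) + (i + 3) ≤ K + 15
pair-bound β i t K β<2 le = begin
  15 * (β + t * 2) + (i + 3)                  ≤⟨ m≤m+n _ (i + 1) ⟩
  15 * (β + t * 2) + (i + 3) + (i + 1)        ≡⟨ regroup β i t ⟩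
  (14 * β + 1) + (3 + (β + (i + t * 15) * 2)) ≤⟨ +-mono-≤ (+-monoˡ-≤ 1 (*-monoʳ-≤ 14 (s≤s⁻¹ β<2))) le ⟩
  15 + K                                      ≡⟨ +-comm 15 K ⟩
  K + 15                                      ∎
  where
  open ≤-Reasoning
  regroup : ∀ β i t → 15 * (β + t * 2) + (i + 3) + (i + 1) ≡ 14 * β + 1 + (3 + (β + (i + t * 15) * 2))
  regroup = solve-∀

pairLevel-bound : ∀ k y → 3 + y ≤ 2 * k → 15 * pairLevel y + (y / 2 % 15 + 3) ≤ 2 * k + 15
pairLevel-bound k y le = pair-bound (y % 2) (y / 2 % 15) (y / 2 / 15) (2 * k) (m%n<n y 2)
  (subst (λ z → 3 + z ≤ 2 * k) (decompose y) le)

pairLevel≤top : ∀ k y → 3 + y ≤ 2 * k → pairLevel y ≤ top k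
pairLevel≤top k y le = *-≤⇒≤-/ 15 (≤-trans (m≤m+n _ _) (pairLevel-bound k y le))

pairCode≤3⇒pairLevel<top : ∀ k y → 3 + y ≤ 2 * k → pairCode y ≤ 3 → pairLevel y < top k
pairCode≤3⇒pairLevel<top k y le code≤3 = *-≤⇒≤-/ 15 (begin
  15 * suc (pairLevel y)       ≡⟨ trans (*-suc 15 (pairLevel y)) (+-comm 15 _) ⟩
  15 * pairLevel y + 15        ≤⟨ +-monoʳ-≤ (15 * pairLevel y) 15≤i+3 ⟩
  15 * pairLevel y + (i + 3)   ≤⟨ pairLevel-bound k y le ⟩
  2 * k + 15                   ∎)
  where
  open ≤-Reasoning
  i : ℕ
  i = y / 2 % 15
  15≤i+3 : 15 ≤ i + 3
  15≤i+3 = ≤-trans (m≤n+m∸n 15 i) (+-monoʳ-≤ i code≤3)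

code-positive : ∀ x → 0 < code x
code-positive 0                   = z<s
code-positive 1                   = z<s
code-positive 2                   = z<s
code-positive (suc (suc (suc y))) = m<n⇒0<n∸m (m%n<n (y / 2) 15)

code<16 : ∀ x → code x < 16
code<16 0                   = s≤s (s≤s z≤n)
code<16 1                   = s≤s (s≤s (s≤s z≤n))
code<16 2                   = s≤s (s≤s (s≤s (s≤s z≤n)))
code<16 (suc (suc (suc y))) = s≤s (m∸n≤m 15 (y / 2 % 15))

pairCode-pairs : ∀ j → pairCode (j * 2) ≡ pairCode (suc (j * 2))
pairCode-pairs j = cong (λ h → 15 ∸ h % 15) (trans ([m+kn]/n≡k {0} j 2 z<s) (sym ([m+kn]/n≡k {1} j 2 (s<s z<s))))

pairLabel-injective : ∀ {y y′} → pairCode y ≡ pairCode y′ → pairLevel y ≡ pairLevel y′ → y ≡ y′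
pairLabel-injective {y} {y′} code≡ level≡ = begin
  y                                                 ≡⟨ decompose y ⟩
  y % 2 + (y / 2 % 15 + y / 2 / 15 * 15) * 2        ≡⟨ cong₂ (λ β j → β + j * 2) parity≡
                                                         (cong₂ (λ i t → i + t * 15) index≡ block≡) ⟩
  y′ % 2 + (y′ / 2 % 15 + y′ / 2 / 15 * 15) * 2     ≡⟨ decompose y′ ⟨
  y′                                                ∎
  where
  open ≡-Reasoning
  level%2 : ∀ z → pairLevel z % 2 ≡ z % 2
  level%2 z = trans ([m+kn]%n≡m%n (z % 2) (z / 2 / 15) 2) (m%n%n≡m%n z 2)
  level/2 : ∀ z → pairLevel z / 2 ≡ z / 2 / 15
  level/2 z = [m+kn]/n≡k (z / 2 / 15) 2 (m%n<n z 2)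
  parity≡ : y % 2 ≡ y′ % 2
  parity≡ = trans (sym (level%2 y)) (trans (cong (_% 2) level≡) (level%2 y′))
  block≡ : y / 2 / 15 ≡ y′ / 2 / 15
  block≡ = trans (sym (level/2 y)) (trans (cong (_/ 2) level≡) (level/2 y′))
  index≡ : y / 2 % 15 ≡ y′ / 2 % 15
  index≡ = ∸-cancelˡ-≡ (<⇒≤ (m%n<n (y / 2) 15)) (<⇒≤ (m%n<n (y′ / 2) 15)) code≡

weight-⊤-even : ∀ j w → (∀ i → w (i * 2) ≡ w (suc (i * 2))) → weight w (⊤ {j * 2}) % 2 ≡ 0
weight-⊤-even zero    w pairs = refl
weight-⊤-even (suc j) w pairs = begin
  (w 0 + (w 1 + rest)) % 2 ≡⟨ cong (_% 2) (+-assoc (w 0) (w 1) rest) ⟨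
  (w 0 + w 1 + rest) % 2   ≡⟨ [m+n]%2≡0 (w 0 + w 1) rest (m%2≡n%2⇒[m+n]%2≡0 (w 0) (w 1) (cong (_% 2) (pairs 0)))
                                         (weight-⊤-even j (w ∘ suc ∘ suc) (pairs ∘ suc)) ⟩
  0                        ∎
  where
  open ≡-Reasoning
  rest : ℕ
  rest = weight (w ∘ suc ∘ suc) (⊤ {j * 2})

bits-of-1+2+3-even : ∀ i → (bit i 1 + (bit i 2 + bit i 3)) % 2 ≡ 0
bits-of-1+2+3-even 0 = refl
bits-of-1+2+3-even 1 = refl
bits-of-1+2+3-even (suc (suc i)) rewrite bit-0 i = refl

code-bits-even : ∀ i j → weight (bit i ∘ code) (⊤ {3 + j * 2}) % 2 ≡ 0
code-bits-even i j = begin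
  (bit i 1 + (bit i 2 + (bit i 3 + rest))) % 2 ≡⟨ cong (_% 2) regroup ⟨
  (bit i 1 + (bit i 2 + bit i 3) + rest) % 2   ≡⟨ [m+n]%2≡0 (bit i 1 + (bit i 2 + bit i 3)) rest
                                                     (bits-of-1+2+3-even i) pairs-even ⟩
  0                                            ∎
  where
  open ≡-Reasoning
  rest : ℕ
  rest = weight (bit i ∘ pairCode) (⊤ {j * 2})
  pairs-even : rest % 2 ≡ 0
  pairs-even = weight-⊤-even j (bit i ∘ pairCode) (cong (bit i) ∘ pairCode-pairs)
  regroup : bit i 1 + (bit i 2 + bit i 3) + rest ≡ bit i 1 + (bit i 2 + (bit i 3 + rest))
  regroup = trans (+-assoc (bit i 1) _ rest) (cong (bit i 1 +_) (+-assoc (bit i 2) (bit i 3) rest))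

small-or-pair : ∀ x → x < 3 ⊎ ∃[ y ] x ≡ 3 + y
small-or-pair 0                   = inj₁ (s≤s z≤n)
small-or-pair 1                   = inj₁ (s≤s (s≤s z≤n))
small-or-pair 2                   = inj₁ (s≤s (s≤s (s≤s z≤n)))
small-or-pair (suc (suc (suc y))) = inj₂ (y , refl)

small-label : ∀ k {x} → x < 3 → code x ≡ suc x × level k x ≡ top k
small-label k {0} _ = refl , refl
small-label k {1} _ = refl , refl
small-label k {2} _ = refl , refl
small-label k {suc (suc (suc _))} (s≤s (s≤s (s≤s ())))

<2k+1⇒≤2k : ∀ k {x} → x < 2 * k + 1 → x ≤ 2 * k
<2k+1⇒≤2k k {x} lt = m<1+n⇒m≤n (subst (x <_) (+-comm (2 * k) 1) lt)

level≤top : ∀ k {x} → x < 2 * k + 1 → level k x ≤ top k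
level≤top k {x} x<n with small-or-pair x
... | inj₁ x<3       = ≤-reflexive (proj₂ (small-label k x<3))
... | inj₂ (y , refl) = pairLevel≤top k y (<2k+1⇒≤2k k x<n)

pairLabel≢smallLabel : ∀ k {x y} → 3 + y < 2 * k + 1 → x < 3 →
                       code (3 + y) ≡ code x → level k (3 + y) ≢ level k x
pairLabel≢smallLabel k {x} {y} y<n x<3 code≡ level≡ = <-irrefl (trans level≡ level-x) below-top
  where
  code-x : code x ≡ suc x
  code-x = proj₁ (small-label k x<3)
  level-x : level k x ≡ top k
  level-x = proj₂ (small-label k x<3)
  below-top : pairLevel y < top k
  below-top = pairCode≤3⇒pairLevel<top k y (<2k+1⇒≤2k k y<n) (subst (_≤ 3) (sym (trans code≡ code-x)) x<3)

code×level-injective : ∀ k {x y} → x < 2 * k + 1 → y < 2 * k + 1 →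
                       code x ≡ code y → level k x ≡ level k y → x ≡ y
code×level-injective k {x} {y} x<n y<n code≡ level≡ with small-or-pair x | small-or-pair y
... | inj₁ x<3         | inj₁ y<3         =
  suc-injective (trans (sym (proj₁ (small-label k x<3))) (trans code≡ (proj₁ (small-label k y<3))))
... | inj₁ x<3         | inj₂ (y′ , refl) = ⊥-elim (pairLabel≢smallLabel k y<n x<3 (sym code≡) (sym level≡))
... | inj₂ (x′ , refl) | inj₁ y<3         = ⊥-elim (pairLabel≢smallLabel k x<n y<3 code≡ level≡)
... | inj₂ (x′ , refl) | inj₂ (y′ , refl) = cong (3 +_) (pairLabel-injective code≡ level≡)

labelling : ∀ k → 1 ≤ k → Labelling (2 * k + 1) 4 (suc (top k))
labelling k@(suc j) _ = record
  { code            = code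
  ; level           = level k
  ; code-nonzero    = λ {x} _ → code-positive x
  ; code<2^r        = λ {x} _ → code<16 x
  ; level<h         = s≤s ∘ level≤top k
  ; code-xor-zero   = λ {i} _ → subst (λ n → weight (bit i ∘ code) (⊤ {n}) % 2 ≡ 0) (size j) (code-bits-even i j)
  ; label-injective = code×level-injective k
  }
  where
  size : ∀ j → 3 + j * 2 ≡ 2 * suc j + 1
  size = solve-∀

colour-count : ∀ k → 15 * (2 ^ 4 * suc (top k)) ≤ 32 * k + 480
colour-count k = begin
  15 * (2 ^ 4 * suc (top k)) ≡⟨ expand (top k) ⟩
  16 * (15 * top k) + 240    ≤⟨ +-monoˡ-≤ 240 (*-monoʳ-≤ 16 15*top≤) ⟩
  16 * (2 * k + 15) + 240    ≡⟨ collect k ⟩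
  32 * k + 480               ∎
  where
  open ≤-Reasoning
  15*top≤ : 15 * top k ≤ 2 * k + 15
  15*top≤ = subst (_≤ 2 * k + 15) (*-comm (top k) 15) (m/n*n≤m (2 * k + 15) 15)
  expand : ∀ t → 15 * (2 ^ 4 * suc t) ≡ 16 * (15 * t) + 240
  expand = solve-∀
  collect : ∀ k → 16 * (2 * k + 15) + 240 ≡ 32 * k + 480
  collect = solve-∀

corollary4p2 : (k : ℕ) → 7 ≤ k →
    Σ ℕ λ c → (15 * c ≤ 32 * k + 480) × ProperColouringK² (2 * k + 1) k c
corollary4p2 k 7≤k =
  2 ^ 4 * suc (top k) , colour-count k , labelling⇒colouring (labelling k (≤-trans (s≤s z≤n) 7≤k))
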